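{- Let $T$ be a quadtree configuration, let $\ell\in\mathbb{N}_0$, and let $p_1, p_2, \ldots, p_k$ be a sequence of empty pixels of $T$ sorted by volume in descending order such that $\sum_{i=1}^k \mathrm{cap}(p_i) \ge 4^{ -\ell} > \sum_{i=1}^{k-1} \mathrm{cap}(p_i)$. Then: (1) $k < 4$ if and only if $k = 1$; (2) if $k \ge 4$, then $\sum_{i=1}^k \mathrm{cap}(p_i) = 4^{ -\ell}$; (3) if $k \ge 4$, then $\mathrm{cap}(p_k) = \mathrm{cap}(p_{k-1}) = \mathrm{cap}(p_{k-2}) = \mathrm{cap}(p_{k-3})$.
   Context: The unit square $[0,1]^2$ is recursively subdivided as a quadtree of unbounded depth: the root (layer $0$) is $[0,1]^2$, and every node (pixel) of layer $j$ is an axis-parallel square of side $2^{ -j}$ whose four children are its four quadrants. A pixel of layer $j$ is a $j$-pixel; its volume is $4^{ -j}$. For $r\in\mathbb{N}_0$, an $r$-square is an axis-parallel square of side $2^{ -r}$. A (quadtree) configuration $T$ assigns finitely many squares to pixels, each $j$-square to a $j$-pixel, at most one square per pixel, such that no pixel with an assigned square is a proper descendant of another pixel with an assigned square. A pixel $p$ contains a square if it is assigned to $p$ or to a descendant of $p$. A pixel with an assigned square is occupied. A pixel that is not occupied is blocked if some ancestor is occupied, free otherwise; a free pixel is empty if it contains no square. The capacity of an empty $j$-pixel is $\mathrm{cap}(p)=4^{ -j}$. -}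

module Defs where

open import Data.Nat using (ℕ; zero; suc; _^_)
open import Data.Nat.Properties using (m^n≢0)
open import Data.Fin using (Fin)
open import Data.List using (List; []; _∷_; _++_; length)
open import Data.List.Membership.Propositional using (_∈_)
open import Data.List.Relation.Unary.Unique.Propositional using (Unique)
open import Data.Integer using (+_)
open import Data.Rational using (ℚ; 0ℚ; _+_; _/_)
open import Data.Product using (Σ; _×_; ∃)
open import Relation.Binary.PropositionalEquality using (_≡_; _≢_)
open import Relation.Nullary using (¬_)

-- A pixel is identified by its path from the root: a list of quadrant
-- choices (one of four children at each step). The root is [] (layer 0);
-- a pixel of layer j is a path of length j.
Pixel : Set
Pixel = List (Fin 4)

layer : Pixel → ℕ
layer = length

_≼_ : Pixel → Pixel → Set
p ≼ q = Σ Pixel (λ s → q ≡ p ++ s)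

_≺_ : Pixel → Pixel → Set
p ≺ q = Σ Pixel (λ s → (s ≢ []) × (q ≡ p ++ s))

vol : ℕ → ℚ
vol j = _/_ (+ 1) (4 ^ j) {{m^n≢0 4 j}}

-- A quadtree configuration, recorded by its finite set of occupied pixels
-- (each occupied j-pixel carries exactly one j-square).
record Config : Set where
  field
    occupied      : List Pixel
    occ-unique    : Unique occupied
    occ-antichain : ∀ {p q} → p ∈ occupied → q ∈ occupied → ¬ (p ≺ q)
open Config public

Occupied : Config → Pixel → Set
Occupied T p = p ∈ occupied T

Blocked : Config → Pixel → Set
Blocked T p = ¬ Occupied T p × ∃ (λ q → (q ∈ occupied T) × (q ≺ p))

Free : Config → Pixel → Set
Free T p = ¬ Occupied T p × ¬ Blocked T p

Contains : Config → Pixel → Set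
Contains T p = ∃ (λ q → (q ∈ occupied T) × (p ≼ q))

EmptyPx : Config → Pixel → Set
EmptyPx T p = Free T p × ¬ Contains T p

cap : Pixel → ℚ
cap p = vol (layer p)

sumTo : (ℕ → ℚ) → ℕ → ℚ
sumTo f zero = 0ℚ
sumTo f (suc n) = sumTo f n + f (suc n)

-- Only the volumes of the pixels matter: every capacity is 4^{-j}, so after measuring
-- in units of 4^{-N} (N at least ℓ and every layer involved) the capacities become
-- non-increasing powers of 4, b 1 ≥ … ≥ b k, and 4^{-ℓ} becomes a power of 4, E.
-- The heart of the argument is a divisibility gap: if S m = b 1 + … + b m < E, then
-- b m divides both S m and E, so S m + b m ≤ E ("room").  Applied to m = k - 1 this
-- squeezes E ≤ S k ≤ S (k-1) + b (k-1) ≤ E, so the sum hits E exactly and b k = b (k-1).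
-- Walking backwards, E = S m + r·c with c = b k and r = 2, 3; room at m gives
-- c ≤ b m ≤ r·c < 4c, forcing b m = c.  For k = 2, 3 the same identity reads E = 2c
-- or E = 3c, impossible for powers of 4; k = 0 is excluded since E > 0.
module Submission where

open import Defs
open import Data.Nat using (ℕ; suc; _∸_; _<_; _≤_)
open import Data.Rational using (ℚ) renaming (_≤_ to _≤ℚ_; _>_ to _>ℚ_)
open import Data.Product using (_×_)
open import Relation.Binary.PropositionalEquality using (_≡_)

open import Data.Nat using (zero; _+_; _*_; _^_; z≤n; s≤s; z<s; NonZero; >-nonZero)
open import Data.Nat.Properties
open import Data.Nat.Divisibility using (_∣_; divides; _∣0; ∣⇒≤; ∣m∣n⇒∣m+n; ∣m+n∣m⇒∣n)
open import Data.Product using (_,_; proj₁; proj₂)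
import Data.Integer as ℤ
import Data.Integer.Properties as ℤP
import Data.Rational as ℚ
import Data.Rational.Properties as ℚP
open import Data.Rational.Unnormalised using (mkℚᵘ; *≡*)
import Data.Nat.Coprimality as Coprimality
open import Data.Sum using (inj₁; inj₂)
open import Data.Empty using (⊥-elim)
open import Relation.Nullary using (contradiction)
open import Relation.Binary.PropositionalEquality using (_≢_; refl; sym; trans; cong; cong₂; subst; subst₂; module ≡-Reasoning)

sumℕ : (ℕ → ℕ) → ℕ → ℕ
sumℕ g zero = 0
sumℕ g (suc m) = sumℕ g m + g (suc m)

term≤sum : ∀ g {i m} → 1 ≤ i → i ≤ m → g i ≤ sumℕ g m
term≤sum g {i} {zero} 1≤i i≤0 = contradiction (≤-trans 1≤i i≤0) λ ()
term≤sum g {i} {suc m} 1≤i i≤1+m with m≤n⇒m<n∨m≡n i≤1+m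
... | inj₂ refl = m≤n+m (g (suc m)) (sumℕ g m)
... | inj₁ i<1+m = ≤-trans (term≤sum g 1≤i (≤-pred i<1+m)) (m≤m+n (sumℕ g m) (g (suc m)))

^-reflects-≤ : ∀ m {x y} → 1 < m → m ^ x ≤ m ^ y → x ≤ y
^-reflects-≤ m 1<m mx≤my = ≮⇒≥ λ y<x → <⇒≱ (^-monoʳ-< m 1<m y<x) mx≤my

^-reflects-< : ∀ m {x y} → 1 < m → m ^ x < m ^ y → x < y
^-reflects-< m {x} {y} 1<m mx<my = ≰⇒> λ y≤x → <⇒≱ mx<my (^-monoʳ-≤ m {{>-nonZero (<-trans z<s 1<m)}} y≤x)

^-∣ : ∀ m {x y} → x ≤ y → m ^ x ∣ m ^ y
^-∣ m {x} {y} x≤y = divides (m ^ (y ∸ x)) (begin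
    m ^ y                 ≡⟨ cong (m ^_) (sym (m+[n∸m]≡n x≤y)) ⟩
    m ^ (x + (y ∸ x))     ≡⟨ ^-distribˡ-+-* m x (y ∸ x) ⟩
    m ^ x * m ^ (y ∸ x)   ≡⟨ *-comm (m ^ x) (m ^ (y ∸ x)) ⟩
    m ^ (y ∸ x) * m ^ x   ∎)
  where open ≡-Reasoning

gap : ∀ {d x y} → d ∣ x → d ∣ y → x < y → x + d ≤ y
gap {d} {x} {y} d∣x d∣y x<y = begin
    x + d         ≤⟨ +-monoʳ-≤ x (∣⇒≤ {{>-nonZero (m<n⇒0<n∸m x<y)}} d∣y∸x) ⟩
    x + (y ∸ x)   ≡⟨ m+[n∸m]≡n (<⇒≤ x<y) ⟩
    y             ∎
  where
  open ≤-Reasoning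
  d∣y∸x : d ∣ y ∸ x
  d∣y∸x = ∣m+n∣m⇒∣n (subst (d ∣_) (sym (m+[n∸m]≡n (<⇒≤ x<y))) d∣y) d∣x

1<4 : 1 < 4
1<4 = s≤s (s≤s z≤n)

between-powers : ∀ {x y} → 4 ^ x ≤ 4 ^ y → 4 ^ y ≤ 3 * 4 ^ x → 4 ^ y ≡ 4 ^ x
between-powers {x} {y} c≤d d≤3c = cong (4 ^_) (≤-antisym (≤-pred y<1+x) (^-reflects-≤ 4 1<4 c≤d))
  where
  y<1+x : y < suc x
  y<1+x = ^-reflects-< 4 1<4 (≤-<-trans d≤3c (*-monoˡ-< (4 ^ x) {{m^n≢0 4 x}} (n<1+n 3)))

not-double-or-triple : ∀ r x y → 2 ≤ r → r ≤ 3 → r * 4 ^ x ≢ 4 ^ y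
not-double-or-triple r x y 2≤r r≤3 rc≡d = <⇒≢ 2≤r (sym r≡1)
  where
  c : ℕ
  c = 4 ^ x
  c≤rc : c ≤ r * c
  c≤rc = m≤n*m c r {{>-nonZero (≤-trans (s≤s z≤n) 2≤r)}}
  d≡c : 4 ^ y ≡ c
  d≡c = between-powers {x} {y} (subst (c ≤_) rc≡d c≤rc) (subst (_≤ 3 * c) rc≡d (*-monoˡ-≤ c r≤3))
  r≡1 : r ≡ 1
  r≡1 = *-cancelʳ-≡ r 1 c {{m^n≢0 4 x}} (trans (trans rc≡d d≡c) (sym (*-identityˡ c)))

module Overshoot (f : ℕ → ℕ) (e : ℕ) where

  b : ℕ → ℕ
  b i = 4 ^ f i

  S : ℕ → ℕ
  S = sumℕ b

  E : ℕ
  E = 4 ^ e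

  Sorted : ℕ → Set
  Sorted k = ∀ i → 1 ≤ i → i < k → b (suc i) ≤ b i

  antitone : ∀ {k i j} → Sorted k → 1 ≤ i → i ≤ j → j ≤ k → b j ≤ b i
  antitone {i = i} {zero} _ 1≤i i≤0 _ = contradiction (≤-trans 1≤i i≤0) λ ()
  antitone {i = i} {suc j} sorted 1≤i i≤1+j 1+j≤k with m≤n⇒m<n∨m≡n i≤1+j
  ... | inj₂ refl = ≤-refl
  ... | inj₁ i<1+j = ≤-trans (sorted j (≤-trans 1≤i i≤j) 1+j≤k) (antitone sorted 1≤i i≤j (<⇒≤ 1+j≤k))
    where
    i≤j : i ≤ j
    i≤j = ≤-pred i<1+j

  -- a term divides every partial sum of the terms before it, all being larger powers of 4
  prefix-divisible : ∀ {k m j} → Sorted k → m ≤ j → j ≤ k → b j ∣ S m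
  prefix-divisible {m = zero} _ _ _ = _ ∣0
  prefix-divisible {m = suc m} {j} sorted 1+m≤j j≤k =
    ∣m∣n⇒∣m+n (prefix-divisible sorted (<⇒≤ 1+m≤j) j≤k)
              (^-∣ 4 (^-reflects-≤ 4 {f j} {f (suc m)} 1<4 (antitone sorted (s≤s z≤n) 1+m≤j j≤k)))

  room : ∀ {k m} → Sorted k → 1 ≤ m → m ≤ k → S m < E → S m + b m ≤ E
  room {m = m} sorted 1≤m m≤k short = gap (prefix-divisible sorted ≤-refl m≤k) bm∣E short
    where
    bm∣E : b m ∣ E
    bm∣E = ^-∣ 4 (<⇒≤ (^-reflects-< 4 {f m} {e} 1<4 (≤-<-trans (term≤sum b 1≤m ≤-refl) short)))

  last-two : ∀ m → Sorted (suc m) → 1 ≤ m → E ≤ S (suc m) → S m < E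
           → (S (suc m) ≡ E) × (b m ≡ b (suc m))
  last-two m sorted 1≤m reach short = ≤-antisym (≤-trans (+-monoʳ-≤ (S m) c≤d) fits) reach , ≤-antisym d≤c c≤d
    where
    c≤d : b (suc m) ≤ b m
    c≤d = sorted m 1≤m ≤-refl
    fits : S m + b m ≤ E
    fits = room sorted 1≤m (n≤1+n m) short
    d≤c : b m ≤ b (suc m)
    d≤c = +-cancelˡ-≤ (S m) (b m) (b (suc m)) (≤-trans fits reach)

  absorb : ∀ m r {c} → b (suc m) ≡ c → S (suc m) + r * c ≡ S m + suc r * c
  absorb m r refl = +-assoc (S m) (b (suc m)) (r * b (suc m))

  run-extends : ∀ {k m} r → Sorted k → 1 ≤ m → m ≤ k → 1 ≤ r → r ≤ 3
              → S m + r * b k ≡ E → b m ≡ b k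
  run-extends {k} {m} r sorted 1≤m m≤k 1≤r r≤3 run =
    between-powers {f k} {f m} (antitone sorted 1≤m m≤k ≤-refl) (≤-trans bm≤rc (*-monoˡ-≤ (b k) r≤3))
    where
    short : S m < E
    short = subst (S m <_) run (m<m+n (S m) (*-mono-≤ 1≤r (m^n>0 4 (f k))))
    bm≤rc : b m ≤ r * b k
    bm≤rc = +-cancelˡ-≤ (S m) _ _ (subst (S m + b m ≤_) (sym run) (room sorted 1≤m m≤k short))

  run-of-two : ∀ j → Sorted (2 + j) → E ≤ S (2 + j) → S (1 + j) < E → S j + 2 * b (2 + j) ≡ E
  run-of-two j sorted reach short = begin
      S j + 2 * b (2 + j)      ≡⟨ absorb j 1 last ⟨
      S (1 + j) + 1 * b (2 + j) ≡⟨ cong (S (1 + j) +_) (*-identityˡ (b (2 + j))) ⟩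
      S (2 + j)                ≡⟨ exact ⟩
      E                        ∎
    where
    open ≡-Reasoning
    exact = proj₁ (last-two (suc j) sorted (s≤s z≤n) reach short)
    last = proj₂ (last-two (suc j) sorted (s≤s z≤n) reach short)

  run-of-three : ∀ i → Sorted (3 + i) → E ≤ S (3 + i) → S (2 + i) < E → S i + 3 * b (3 + i) ≡ E
  run-of-three i sorted reach short = begin
      S i + 3 * b (3 + i)        ≡⟨ absorb i 2 third ⟨
      S (1 + i) + 2 * b (3 + i)  ≡⟨ run₂ ⟩
      E                          ∎
    where
    open ≡-Reasoning
    run₂ = run-of-two (suc i) sorted reach short
    third = run-extends 2 sorted (s≤s z≤n) (m≤n+m (1 + i) 2) (s≤s z≤n) (s≤s (s≤s z≤n)) run₂

  Overshoots : ℕ → Set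
  Overshoots k = (k < 4 → k ≡ 1) × (4 ≤ k → S k ≡ E)
                 × (4 ≤ k → (b k ≡ b (k ∸ 1)) × (b (k ∸ 1) ≡ b (k ∸ 2)) × (b (k ∸ 2) ≡ b (k ∸ 3)))

  overshoot : ∀ k → Sorted k → E ≤ S k → S (k ∸ 1) < E → Overshoots k
  overshoot 0 _ reach _ = ⊥-elim (<⇒≱ (m^n>0 4 e) reach)
  overshoot 1 _ _ _ = (λ _ → refl) , (λ { (s≤s ()) }) , (λ { (s≤s ()) })
  overshoot 2 sorted reach short =
    ⊥-elim (not-double-or-triple 2 (f 2) e ≤-refl (n≤1+n 2) (run-of-two 0 sorted reach short))
  overshoot 3 sorted reach short =
    ⊥-elim (not-double-or-triple 3 (f 3) e (n≤1+n 2) ≤-refl (run-of-three 0 sorted reach short))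
  overshoot k@(suc (suc (suc (suc h)))) sorted reach short =
      (λ { (s≤s (s≤s (s≤s (s≤s ())))) })
    , (λ _ → proj₁ last)
    , (λ _ → sym (proj₂ last) , trans (proj₂ last) (sym third) , trans third (sym fourth))
    where
    last : (S k ≡ E) × (b (3 + h) ≡ b k)
    last = last-two (3 + h) sorted (s≤s z≤n) reach short
    third : b (2 + h) ≡ b k
    third = run-extends 2 sorted (s≤s z≤n) (m≤n+m (2 + h) 2) (s≤s z≤n) (n≤1+n 2) (run-of-two (2 + h) sorted reach short)
    fourth : b (1 + h) ≡ b k
    fourth = run-extends 3 sorted (s≤s z≤n) (m≤n+m (1 + h) 3) (s≤s z≤n) ≤-refl (run-of-three (1 + h) sorted reach short)

module Rescaling where

  open import Data.Integer using (+_)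

  ι : ℕ → ℚ
  ι n = ℚ.mkℚ (+ n) 0 (Coprimality.sym (Coprimality.1-coprimeTo n))

  ι-+ : ∀ m n → ι (m + n) ≡ ι m ℚ.+ ι n
  ι-+ m n = begin
      ι (m + n)                             ≡⟨ ℚP.↥p/↧p≡p (ι (m + n)) ⟨
      + (m + n) ℚ./ 1                       ≡⟨ ℚP./-cong numerator refl ⟩
      (+ m ℤ.* + 1 ℤ.+ + n ℤ.* + 1) ℚ./ 1   ≡⟨⟩
      ι m ℚ.+ ι n                           ∎
    where
    open ≡-Reasoning
    numerator : + (m + n) ≡ + m ℤ.* + 1 ℤ.+ + n ℤ.* + 1
    numerator = trans (ℤP.pos-+ m n) (sym (cong₂ ℤ._+_ (ℤP.*-identityʳ (+ m)) (ℤP.*-identityʳ (+ n))))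

  ι-reflects-≤ : ∀ {m n} → ι m ℚ.≤ ι n → m ≤ n
  ι-reflects-≤ {m} {n} (ℚ.*≤* m≤n) =
    ℤP.drop‿+≤+ (subst₂ ℤ._≤_ (ℤP.*-identityʳ (+ m)) (ℤP.*-identityʳ (+ n)) m≤n)

  ι-reflects-< : ∀ {m n} → ι m ℚ.< ι n → m < n
  ι-reflects-< {m} {n} (ℚ.*<* m<n) =
    ℤP.drop‿+<+ (subst₂ ℤ._<_ (ℤP.*-identityʳ (+ m)) (ℤP.*-identityʳ (+ n)) m<n)

  unit-fraction-scale : ∀ n d e .{{_ : NonZero n}} .{{_ : NonZero e}} → n * d ≡ e
                      → + 1 ℚ./ n ≡ ι d ℚ.* (+ 1 ℚ./ e)
  unit-fraction-scale (suc n) d (suc e) nd≡e = begin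
      + 1 ℚ./ suc n                        ≡⟨ ℚP.fromℚᵘ-cong {mkℚᵘ (+ 1) n} {mkℚᵘ (+ d ℤ.* + 1) (e + 0)} (*≡* cross) ⟩
      (+ d ℤ.* + 1) ℚ./ suc (e + 0)        ≡⟨⟩
      ι d ℚ.* 1/e                          ≡⟨ cong (ι d ℚ.*_) (ℚP.↥p/↧p≡p 1/e) ⟨
      ι d ℚ.* (+ 1 ℚ./ suc e)              ∎
    where
    open ≡-Reasoning
    1/e : ℚ
    1/e = ℚ.mkℚ (+ 1) e (Coprimality.1-coprimeTo (suc e))
    cross : + 1 ℤ.* + suc (e + 0) ≡ (+ d ℤ.* + 1) ℤ.* + suc n
    cross = begin
      + 1 ℤ.* + suc (e + 0)     ≡⟨ ℤP.*-identityˡ _ ⟩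
      + suc (e + 0)             ≡⟨ cong (λ x → + suc x) (+-identityʳ e) ⟩
      + suc e                   ≡⟨ cong +_ nd≡e ⟨
      + (suc n * d)             ≡⟨ ℤP.pos-* (suc n) d ⟩
      + suc n ℤ.* + d           ≡⟨ ℤP.*-comm (+ suc n) (+ d) ⟩
      + d ℤ.* + suc n           ≡⟨ cong (ℤ._* + suc n) (ℤP.*-identityʳ (+ d)) ⟨
      (+ d ℤ.* + 1) ℤ.* + suc n ∎

  module Units (N : ℕ) where

    ⟦_⟧ : ℕ → ℚ
    ⟦ n ⟧ = ι n ℚ.* vol N

    ⟦⟧-+ : ∀ m n → ⟦ m + n ⟧ ≡ ⟦ m ⟧ ℚ.+ ⟦ n ⟧
    ⟦⟧-+ m n = trans (cong (ℚ._* vol N) (ι-+ m n)) (ℚP.*-distribʳ-+ (vol N) (ι m) (ι n))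

    unit-positive : ℚ.Positive (vol N)
    unit-positive = ℚP.normalize-pos 1 (4 ^ N) {{m^n≢0 4 N}}

    ⟦⟧-reflects-≤ : ∀ {m n} → ⟦ m ⟧ ℚ.≤ ⟦ n ⟧ → m ≤ n
    ⟦⟧-reflects-≤ le = ι-reflects-≤ (ℚP.*-cancelʳ-≤-pos (vol N) {{unit-positive}} le)

    ⟦⟧-reflects-< : ∀ {m n} → ⟦ m ⟧ ℚ.< ⟦ n ⟧ → m < n
    ⟦⟧-reflects-< lt = ι-reflects-< (ℚP.*-cancelʳ-<-nonNeg (vol N) {{ℚP.pos⇒nonNeg (vol N) {{unit-positive}}}} lt)

    vol-in-units : ∀ {j} → j ≤ N → vol j ≡ ⟦ 4 ^ (N ∸ j) ⟧
    vol-in-units {j} j≤N = unit-fraction-scale (4 ^ j) (4 ^ (N ∸ j)) (4 ^ N) {{m^n≢0 4 j}} {{m^n≢0 4 N}}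
      (trans (sym (^-distribˡ-+-* 4 j (N ∸ j))) (cong (4 ^_) (m+[n∸m]≡n j≤N)))

    sum-in-units : ∀ (a : ℕ → ℕ) m → (∀ i → 1 ≤ i → i ≤ m → a i ≤ N)
                 → sumTo (λ i → vol (a i)) m ≡ ⟦ sumℕ (λ i → 4 ^ (N ∸ a i)) m ⟧
    sum-in-units a zero _ = sym (ℚP.*-zeroˡ (vol N))
    sum-in-units a (suc m) bounded = begin
        sumTo (λ i → vol (a i)) m ℚ.+ vol (a (suc m))
          ≡⟨ cong₂ ℚ._+_ (sum-in-units a m (λ i 1≤i i≤m → bounded i 1≤i (m≤n⇒m≤1+n i≤m)))
                         (vol-in-units (bounded (suc m) (s≤s z≤n) ≤-refl)) ⟩
        ⟦ sumℕ (λ i → 4 ^ (N ∸ a i)) m ⟧ ℚ.+ ⟦ 4 ^ (N ∸ a (suc m)) ⟧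
          ≡⟨ ⟦⟧-+ (sumℕ (λ i → 4 ^ (N ∸ a i)) m) (4 ^ (N ∸ a (suc m))) ⟨
        ⟦ sumℕ (λ i → 4 ^ (N ∸ a i)) (suc m) ⟧ ∎
      where open ≡-Reasoning

-- Measuring the capacities of p 1, …, p k and the target 4^{-ℓ} in units of 4^{-N}, for N
-- at least ℓ and every layer involved, turns them into the powers of 4 of Overshoot.
module InUnits (ℓ k : ℕ) (p : ℕ → Pixel) where

  a : ℕ → ℕ
  a i = layer (p i)

  N : ℕ
  N = ℓ + sumℕ a k

  open Rescaling.Units N public
  open Overshoot (λ i → N ∸ a i) (N ∸ ℓ) public

  layer-bounded : ∀ {i} → 1 ≤ i → i ≤ k → a i ≤ N
  layer-bounded 1≤i i≤k = ≤-trans (term≤sum a 1≤i i≤k) (m≤n+m _ ℓ)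

  target-in-units : vol ℓ ≡ ⟦ E ⟧
  target-in-units = vol-in-units (m≤m+n ℓ _)

  cap-in-units : ∀ {i} → 1 ≤ i → i ≤ k → cap (p i) ≡ ⟦ b i ⟧
  cap-in-units 1≤i i≤k = vol-in-units (layer-bounded 1≤i i≤k)

  caps-in-units : ∀ {m} → m ≤ k → sumTo (λ i → cap (p i)) m ≡ ⟦ S m ⟧
  caps-in-units {m} m≤k = sum-in-units a m λ i 1≤i i≤m → layer-bounded 1≤i (≤-trans i≤m m≤k)

  sorted-in-units : (∀ i → 1 ≤ i → i < k → cap (p (suc i)) ≤ℚ cap (p i)) → Sorted k
  sorted-in-units sorted i 1≤i i<k =
    ⟦⟧-reflects-≤ (subst₂ _≤ℚ_ (cap-in-units (s≤s z≤n) i<k) (cap-in-units 1≤i (<⇒≤ i<k)) (sorted i 1≤i i<k))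

  reach-in-units : vol ℓ ≤ℚ sumTo (λ i → cap (p i)) k → E ≤ S k
  reach-in-units reach = ⟦⟧-reflects-≤ (subst₂ _≤ℚ_ target-in-units (caps-in-units ≤-refl) reach)

  short-in-units : vol ℓ >ℚ sumTo (λ i → cap (p i)) (k ∸ 1) → S (k ∸ 1) < E
  short-in-units short = ⟦⟧-reflects-< (subst₂ ℚ._<_ (caps-in-units (m∸n≤m k 1)) target-in-units short)

  last-four-cap : 4 ≤ k → ∀ r s → r ≤ 3 → s ≤ 3 → b (k ∸ r) ≡ b (k ∸ s) → cap (p (k ∸ r)) ≡ cap (p (k ∸ s))
  last-four-cap 4≤k r s r≤3 s≤3 eq =
    trans (cap-in-units (among-last-four r≤3) (m∸n≤m k r))
          (trans (cong ⟦_⟧ eq) (sym (cap-in-units (among-last-four s≤3) (m∸n≤m k s))))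
    where
    among-last-four : ∀ {t} → t ≤ 3 → 1 ≤ k ∸ t
    among-last-four {t} t≤3 = ≤-trans (∸-monoˡ-≤ 3 4≤k) (∸-monoʳ-≤ k t≤3)

lemma2 : (T : Config) (ℓ k : ℕ) (p : ℕ → Pixel)
         → (∀ i → 1 ≤ i → i ≤ k → EmptyPx T (p i))
         → (∀ i → 1 ≤ i → i < k → vol (layer (p (suc i))) ≤ℚ vol (layer (p i)))
         → vol ℓ ≤ℚ sumTo (λ i → cap (p i)) k
         → vol ℓ >ℚ sumTo (λ i → cap (p i)) (k ∸ 1)
         → ((k < 4 → k ≡ 1) × (k ≡ 1 → k < 4))
           × (4 ≤ k → sumTo (λ i → cap (p i)) k ≡ vol ℓ)
           × (4 ≤ k → (cap (p k) ≡ cap (p (k ∸ 1)))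
                      × (cap (p (k ∸ 1)) ≡ cap (p (k ∸ 2)))
                      × (cap (p (k ∸ 2)) ≡ cap (p (k ∸ 3))))
lemma2 _ ℓ k p _ sorted reach short =
    (small , λ { refl → s≤s (s≤s z≤n) })
  , (λ 4≤k → trans (caps-in-units ≤-refl) (trans (cong ⟦_⟧ (exact 4≤k)) (sym target-in-units)))
  , λ 4≤k → let (e₁ , e₂ , e₃) = run 4≤k in
      last-four-cap 4≤k 0 1 z≤n (s≤s z≤n) e₁ ,
      last-four-cap 4≤k 1 2 (s≤s z≤n) (s≤s (s≤s z≤n)) e₂ ,
      last-four-cap 4≤k 2 3 (s≤s (s≤s z≤n)) ≤-refl e₃
  where
  open InUnits ℓ k p
  shape : Overshoots k
  shape = overshoot k (sorted-in-units sorted) (reach-in-units reach) (short-in-units short)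
  small : k < 4 → k ≡ 1
  small = proj₁ shape
  exact : 4 ≤ k → S k ≡ E
  exact = proj₁ (proj₂ shape)
  run : 4 ≤ k → (b k ≡ b (k ∸ 1)) × (b (k ∸ 1) ≡ b (k ∸ 2)) × (b (k ∸ 2) ≡ b (k ∸ 3))
  run = proj₂ (proj₂ shape)
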